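{- Let $p$ be a prime, $k\ge1$, and let $V$ be an $\mathbb{F}_p$-linear subspace of $\mathbb{F}_p^{2k}$. Then there exist a maximal unlinked set $\mathcal{U}$ and a vector $a\in\mathbb{F}_p^{2k}$ with $\mathcal{U}=V+a$ if and only if \[ V=\{x\in\mathbb{F}_p^{2k}:\ \pi_o(x)\in\pi_e(V)^{\perp}\ \text{and}\ \pi_e(x)\in\pi_e(V)\}, \] i.e. $V=\pi_e(V)^{\perp}\oplus\pi_e(V)$ with $\pi_e(V)^\perp$ placed in the odd coordinates and $\pi_e(V)$ in the even coordinates.
   Context: Write elements of $\mathbb{F}_p^{2k}$ as $u=(u_{11},u_{12},u_{21},u_{22},\ldots,u_{k1},u_{k2})$. Let $\pi_e(u)=(u_{12},u_{22},\ldots,u_{k2})\in\mathbb{F}_p^k$ (even coordinates) and $\pi_o(u)=(u_{11},u_{21},\ldots,u_{k1})\in\mathbb{F}_p^k$ (odd coordinates). For $W\subseteq\mathbb{F}_p^k$, $W^{\perp}=\{y\in\mathbb{F}_p^k:\sum_i y_iw_i=0\ \forall w\in W\}$. Define $\Phi_k(u,v)=\sum_{i=1}^{k}u_{i1}(v_{i2}-u_{i2})$. A subset $\mathcal{U}\subseteq\mathbb{F}_p^{2k}$ is unlinked if $\Phi_k(u,v)=0$ for all $u,v\in\mathcal{U}$; it is maximal unlinked if it is unlinked and not properly contained in another unlinked subset. -}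

module Defs where

open import Data.Nat using (ℕ; zero; suc; _+_; _*_; _∸_; NonZero)
open import Data.Nat.DivMod using (_mod_)
open import Data.Nat.Primality using (Prime; prime⇒nonZero)
open import Data.Fin using (Fin; toℕ)
open import Data.Vec using (Vec; []; _∷_; map; zipWith; foldr; replicate)
open import Data.Product using (_×_; _,_; proj₁; proj₂; Σ; ∃)
open import Data.Bool using (Bool; true)
open import Relation.Binary.PropositionalEquality using (_≡_)
open import Function.Bundles using (_⇔_)

module _ (p : ℕ) (pp : Prime p) where
  private instance
    nz : NonZero p
    nz = prime⇒nonZero pp

  𝔽 : Set
  𝔽 = Fin p

  0F : 𝔽
  0F = 0 mod p

  _+F_ : 𝔽 → 𝔽 → 𝔽
  a +F b = (toℕ a + toℕ b) mod p

  _*F_ : 𝔽 → 𝔽 → 𝔽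
  a *F b = (toℕ a * toℕ b) mod p

  -F_ : 𝔽 → 𝔽
  -F a = (p ∸ toℕ a) mod p

  _-F_ : 𝔽 → 𝔽 → 𝔽
  a -F b = a +F (-F b)

  Vk : ℕ → Set
  Vk k = Vec 𝔽 k

  -- 𝔽_p^{2k}, written u = ((u₁₁,u₁₂),…,(u_k1,u_k2)).
  V2k : ℕ → Set
  V2k k = Vec (𝔽 × 𝔽) k

  πe : ∀ {k} → V2k k → Vk k
  πe = map proj₂

  πo : ∀ {k} → V2k k → Vk k
  πo = map proj₁

  dot : ∀ {k} → Vk k → Vk k → 𝔽
  dot x y = foldr _ _+F_ 0F (zipWith _*F_ x y)

  _⊕_ : ∀ {k} → V2k k → V2k k → V2k k
  u ⊕ v = zipWith (λ a b → (proj₁ a +F proj₁ b , proj₂ a +F proj₂ b)) u v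

  _·_ : ∀ {k} → 𝔽 → V2k k → V2k k
  c · u = map (λ a → (c *F proj₁ a , c *F proj₂ a)) u

  zero2k : ∀ {k} → V2k k
  zero2k = replicate _ (0F , 0F)

  Φ : ∀ {k} → V2k k → V2k k → 𝔽
  Φ u v = foldr _ _+F_ 0F
            (zipWith (λ a b → proj₁ a *F (proj₂ b -F proj₂ a)) u v)

  Subset2k : ℕ → Set
  Subset2k k = V2k k → Bool

  _∈_ : ∀ {k} → V2k k → Subset2k k → Set
  x ∈ S = S x ≡ true

  _⊆_ : ∀ {k} → Subset2k k → Subset2k k → Set
  S ⊆ T = ∀ x → x ∈ S → x ∈ T

  IsSubspace : ∀ {k} → Subset2k k → Set
  IsSubspace V = (zero2k ∈ V)
               × (∀ x y → x ∈ V → y ∈ V → (x ⊕ y) ∈ V)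
               × (∀ c x → x ∈ V → (c · x) ∈ V)

  Unlinked : ∀ {k} → Subset2k k → Set
  Unlinked U = ∀ u v → u ∈ U → v ∈ U → Φ u v ≡ 0F

  MaximalUnlinked : ∀ {k} → Subset2k k → Set
  MaximalUnlinked U = Unlinked U × (∀ U′ → Unlinked U′ → U ⊆ U′ → U′ ⊆ U)

  IsTranslate : ∀ {k} → Subset2k k → Subset2k k → V2k k → Set
  IsTranslate U V a = ∀ x → (x ∈ U) ⇔ (∃ λ v → v ∈ V × x ≡ v ⊕ a)

  InπeV : ∀ {k} → Subset2k k → Vk k → Set
  InπeV V y = ∃ λ v → v ∈ V × πe v ≡ y

  InπeV⊥ : ∀ {k} → Subset2k k → Vk k → Set
  InπeV⊥ V y = ∀ w → InπeV V w → dot y w ≡ 0F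

  SplitForm : ∀ {k} → Subset2k k → Set
  SplitForm V = ∀ x → (x ∈ V) ⇔ (InπeV⊥ V (πo x) × InπeV V (πe x))

module Submission where

-- With the pairing D(s,t) = π_o(s)·π_e(t) we have Φ(u,v) = D(u,v) − D(u,u),
-- and bilinearity of the dot product gives the key identity
--   (★)  Φ(s+a, t+a) = (D(s,t) − D(s,s)) + (D(a,t) − D(a,s)).
-- Call x split if π_o(x) ∈ W^⊥ and π_e(x) ∈ W.
-- (⇒) If V + a is unlinked, (★) at (0,t), (s,0) and (s,t) shows π_o(a) ⊥ W
--     and that every v ∈ V is split; conversely, by (★) adding x + a for a
--     split x keeps V + a unlinked, so maximality forces x ∈ V.
-- (⇐) V = V + 0 is unlinked by (★).  A vector x linked to nothing in V has
--     π_o(x) ⊥ W, and π_e(x) ∈ W by double orthogonality: otherwise some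
--     z ∈ W^⊥ has z·π_e(x) ≠ 0 and the split vector (z, 0) ∈ V links with x.

open import Defs
open import Data.Nat using (ℕ; _≥_)
open import Data.Nat.Primality using (Prime)
open import Data.Product using (_×_; Σ; ∃)
open import Function.Bundles using (_⇔_)

open import Level using (0ℓ)
open import Data.Nat as ℕ using (zero; suc; NonZero; _%_)
import Data.Nat.Properties as ℕ
open import Data.Nat.DivMod
  using (_mod_; m%n<n; %-distribˡ-+; %-distribˡ-*; m<n⇒m%n≡m; n%n≡0; m*n%n≡0; [m+kn]%n≡m%n)
open import Data.Nat.Primality using (prime⇒nonZero)
open import Data.Nat.Coprimality using (prime⇒coprime; coprime-Bézout)
open import Data.Nat.GCD using (module Bézout)
open import Data.Fin as Fin using (Fin; toℕ)
open import Data.Fin.Properties using (toℕ-fromℕ<; toℕ-injective; toℕ<n; toℕ≤n; any?)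
open import Data.Vec using (Vec; []; _∷_; head; map; zipWith; replicate)
open import Data.Vec.Properties as Vec using (∷-injectiveˡ; ∷-injectiveʳ)
import Data.Product.Properties as Product
open import Data.Bool as Bool using (Bool; true; false; _∨_)
open import Data.Bool.Properties using (∨-zeroʳ)
open import Data.Product using (_,_; proj₁; proj₂)
open import Data.Sum using (_⊎_; inj₁; inj₂)
open import Data.Empty using (⊥-elim)
open import Relation.Binary.Definitions using (DecidableEquality)
open import Relation.Binary.PropositionalEquality
open import Relation.Nullary using (Dec; yes; no; ¬_; ¬?)
open import Relation.Nullary.Decidable using (map′; ⌊_⌋; _×-dec_; decidable-stable)
open import Algebra.Bundles using (CommutativeRing)
open import Algebra.Structures using (IsCommutativeRing)
open import Function.Bundles using (mk⇔; Equivalence)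

-- Exhaustive search: every decidable predicate on a finite type has a
-- decidable existential.  Needed to decide membership in π_e(V).
Exhaustible : Set → Set₁
Exhaustible A = ∀ {Q : A → Set} → (∀ x → Dec (Q x)) → Dec (∃ Q)

Fin-exhaustible : ∀ {n} → Exhaustible (Fin n)
Fin-exhaustible = any?

×-exhaustible : ∀ {A B} → Exhaustible A → Exhaustible B → Exhaustible (A × B)
×-exhaustible searchA searchB Q? =
  map′ (λ { (a , b , q) → (a , b) , q }) (λ { ((a , b) , q) → a , b , q })
       (searchA (λ a → searchB (λ b → Q? (a , b))))

Vec-exhaustible : ∀ {A} → Exhaustible A → ∀ k → Exhaustible (Vec A k)
Vec-exhaustible searchA zero Q? = map′ ([] ,_) (λ { ([] , q) → q }) (Q? [])
Vec-exhaustible searchA (suc k) Q? =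
  map′ (λ { (a , v , q) → (a ∷ v) , q }) (λ { ((a ∷ v) , q) → a , v , q })
       (searchA (λ a → Vec-exhaustible searchA k (λ v → Q? (a ∷ v))))

module _ {A : Set} (_≟_ : DecidableEquality A) where
  insert : A → (A → Bool) → (A → Bool)
  insert y U z = U z ∨ ⌊ z ≟ y ⌋

  insert-⊇ : ∀ y U z → U z ≡ true → insert y U z ≡ true
  insert-⊇ y U z z∈U = cong (_∨ ⌊ z ≟ y ⌋) z∈U

  insert-∋ : ∀ y U → insert y U y ≡ true
  insert-∋ y U with y ≟ y
  ... | yes _ = ∨-zeroʳ (U y)
  ... | no y≢y = ⊥-elim (y≢y refl)

  insert-cases : ∀ y U z → insert y U z ≡ true → U z ≡ true ⊎ z ≡ y
  insert-cases y U z z∈ with U z | z ≟ y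
  ... | true  | _        = inj₁ refl
  ... | false | yes z≡y  = inj₂ z≡y
  ... | false | no _ with z∈
  ...   | ()

module _ (p : ℕ) (pp : Prime p) where
  private instance
    p≢0 : NonZero p
    p≢0 = prime⇒nonZero pp

  -- 𝔽_p as a commutative ring.  Every law is inherited from ℕ along the
  -- surjective reduction map ⟦_⟧ : ℕ → 𝔽_p, which preserves + and *.
  Fp : Set
  Fp = 𝔽 p pp

  infixl 6 _+_ _-_
  infixl 7 _*_
  infix 8 -_

  _+_ _*_ _-_ : Fp → Fp → Fp
  _+_ = _+F_ p pp
  _*_ = _*F_ p pp
  _-_ = _-F_ p pp

  -_ : Fp → Fp
  -_ = -F_ p pp

  0# 1# : Fp
  0# = 0F p pp
  1# = 1 mod p

  ⟦_⟧ : ℕ → Fp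
  ⟦ n ⟧ = n mod p

  toℕ-⟦⟧ : ∀ n → toℕ ⟦ n ⟧ ≡ n % p
  toℕ-⟦⟧ n = toℕ-fromℕ< (m%n<n n p)

  ⟦toℕ⟧ : ∀ a → ⟦ toℕ a ⟧ ≡ a
  ⟦toℕ⟧ a = toℕ-injective (trans (toℕ-⟦⟧ (toℕ a)) (m<n⇒m%n≡m (toℕ<n a)))

  ⟦⟧-cong : ∀ {m n} → m % p ≡ n % p → ⟦ m ⟧ ≡ ⟦ n ⟧
  ⟦⟧-cong {m} {n} eq = toℕ-injective (trans (toℕ-⟦⟧ m) (trans eq (sym (toℕ-⟦⟧ n))))

  ⟦⟧-+ : ∀ m n → ⟦ m ⟧ + ⟦ n ⟧ ≡ ⟦ m ℕ.+ n ⟧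
  ⟦⟧-+ m n = ⟦⟧-cong (trans (cong₂ (λ x y → (x ℕ.+ y) % p) (toℕ-⟦⟧ m) (toℕ-⟦⟧ n))
                            (sym (%-distribˡ-+ m n p)))

  ⟦⟧-* : ∀ m n → ⟦ m ⟧ * ⟦ n ⟧ ≡ ⟦ m ℕ.* n ⟧
  ⟦⟧-* m n = ⟦⟧-cong (trans (cong₂ (λ x y → (x ℕ.* y) % p) (toℕ-⟦⟧ m) (toℕ-⟦⟧ n))
                            (sym (%-distribˡ-* m n p)))

  ⟦p⟧ : ⟦ p ⟧ ≡ 0#
  ⟦p⟧ = ⟦⟧-cong (trans (n%n≡0 p) (sym (m*n%n≡0 0 p)))

  elim₁ : (P : Fp → Set) → (∀ x → P ⟦ x ⟧) → ∀ a → P a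
  elim₁ P h a = subst P (⟦toℕ⟧ a) (h (toℕ a))

  elim₃ : (P : Fp → Fp → Fp → Set) → (∀ x y z → P ⟦ x ⟧ ⟦ y ⟧ ⟦ z ⟧) → ∀ a b c → P a b c
  elim₃ P h a b c =
    elim₁ (λ a → P a b c) (λ x → elim₁ (P ⟦ x ⟧ b) (λ z →
      elim₁ (λ b → P ⟦ x ⟧ b ⟦ z ⟧) (λ y → h x y z) b) c) a

  +-assoc : ∀ a b c → (a + b) + c ≡ a + (b + c)
  +-assoc = elim₃ (λ a b c → (a + b) + c ≡ a + (b + c)) λ x y z → begin
      (⟦ x ⟧ + ⟦ y ⟧) + ⟦ z ⟧  ≡⟨ cong (_+ ⟦ z ⟧) (⟦⟧-+ x y) ⟩
      ⟦ x ℕ.+ y ⟧ + ⟦ z ⟧      ≡⟨ ⟦⟧-+ (x ℕ.+ y) z ⟩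
      ⟦ x ℕ.+ y ℕ.+ z ⟧        ≡⟨ cong ⟦_⟧ (ℕ.+-assoc x y z) ⟩
      ⟦ x ℕ.+ (y ℕ.+ z) ⟧      ≡⟨ ⟦⟧-+ x (y ℕ.+ z) ⟨
      ⟦ x ⟧ + ⟦ y ℕ.+ z ⟧      ≡⟨ cong (⟦ x ⟧ +_) (⟦⟧-+ y z) ⟨
      ⟦ x ⟧ + (⟦ y ⟧ + ⟦ z ⟧)  ∎
    where open ≡-Reasoning

  *-assoc : ∀ a b c → (a * b) * c ≡ a * (b * c)
  *-assoc = elim₃ (λ a b c → (a * b) * c ≡ a * (b * c)) λ x y z → begin
      (⟦ x ⟧ * ⟦ y ⟧) * ⟦ z ⟧  ≡⟨ cong (_* ⟦ z ⟧) (⟦⟧-* x y) ⟩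
      ⟦ x ℕ.* y ⟧ * ⟦ z ⟧      ≡⟨ ⟦⟧-* (x ℕ.* y) z ⟩
      ⟦ x ℕ.* y ℕ.* z ⟧        ≡⟨ cong ⟦_⟧ (ℕ.*-assoc x y z) ⟩
      ⟦ x ℕ.* (y ℕ.* z) ⟧      ≡⟨ ⟦⟧-* x (y ℕ.* z) ⟨
      ⟦ x ⟧ * ⟦ y ℕ.* z ⟧      ≡⟨ cong (⟦ x ⟧ *_) (⟦⟧-* y z) ⟨
      ⟦ x ⟧ * (⟦ y ⟧ * ⟦ z ⟧)  ∎
    where open ≡-Reasoning

  distribʳ : ∀ a b c → (b + c) * a ≡ b * a + c * a
  distribʳ = elim₃ (λ a b c → (b + c) * a ≡ b * a + c * a) λ x y z → begin
      (⟦ y ⟧ + ⟦ z ⟧) * ⟦ x ⟧      ≡⟨ cong (_* ⟦ x ⟧) (⟦⟧-+ y z) ⟩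
      ⟦ y ℕ.+ z ⟧ * ⟦ x ⟧          ≡⟨ ⟦⟧-* (y ℕ.+ z) x ⟩
      ⟦ (y ℕ.+ z) ℕ.* x ⟧          ≡⟨ cong ⟦_⟧ (ℕ.*-distribʳ-+ x y z) ⟩
      ⟦ y ℕ.* x ℕ.+ z ℕ.* x ⟧      ≡⟨ ⟦⟧-+ (y ℕ.* x) (z ℕ.* x) ⟨
      ⟦ y ℕ.* x ⟧ + ⟦ z ℕ.* x ⟧    ≡⟨ cong₂ _+_ (⟦⟧-* y x) (⟦⟧-* z x) ⟨
      ⟦ y ⟧ * ⟦ x ⟧ + ⟦ z ⟧ * ⟦ x ⟧ ∎
    where open ≡-Reasoning

  +-comm : ∀ a b → a + b ≡ b + a
  +-comm a b = ⟦⟧-cong (cong (_% p) (ℕ.+-comm (toℕ a) (toℕ b)))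

  *-comm : ∀ a b → a * b ≡ b * a
  *-comm a b = ⟦⟧-cong (cong (_% p) (ℕ.*-comm (toℕ a) (toℕ b)))

  +-identityˡ : ∀ a → 0# + a ≡ a
  +-identityˡ = elim₁ (λ a → 0# + a ≡ a) λ x → ⟦⟧-+ 0 x

  *-identityˡ : ∀ a → 1# * a ≡ a
  *-identityˡ = elim₁ (λ a → 1# * a ≡ a) λ x →
    trans (⟦⟧-* 1 x) (cong ⟦_⟧ (ℕ.*-identityˡ x))

  -‿inverseˡ : ∀ a → - a + a ≡ 0#
  -‿inverseˡ a = begin
      - a + a                       ≡⟨ cong (- a +_) (⟦toℕ⟧ a) ⟨
      ⟦ p ℕ.∸ toℕ a ⟧ + ⟦ toℕ a ⟧   ≡⟨ ⟦⟧-+ (p ℕ.∸ toℕ a) (toℕ a) ⟩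
      ⟦ p ℕ.∸ toℕ a ℕ.+ toℕ a ⟧     ≡⟨ cong ⟦_⟧ (ℕ.m∸n+n≡m (toℕ≤n a)) ⟩
      ⟦ p ⟧                         ≡⟨ ⟦p⟧ ⟩
      0#                            ∎
    where open ≡-Reasoning

  -- The remaining laws follow from the ones above by commutativity.
  isCommutativeRing : IsCommutativeRing _≡_ _+_ _*_ -_ 0# 1#
  isCommutativeRing = record
    { isRing = record
      { +-isAbelianGroup = record
        { isGroup = record
          { isMonoid = record
            { isSemigroup = record
              { isMagma = record { isEquivalence = isEquivalence ; ∙-cong = cong₂ _+_ }
              ; assoc = +-assoc }
            ; identity = +-identityˡ , λ a → trans (+-comm a 0#) (+-identityˡ a) }
          ; inverse = -‿inverseˡ , λ a → trans (+-comm a (- a)) (-‿inverseˡ a)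
          ; ⁻¹-cong = cong (-_) }
        ; comm = +-comm }
      ; *-cong = cong₂ _*_
      ; *-assoc = *-assoc
      ; *-identity = *-identityˡ , λ a → trans (*-comm a 1#) (*-identityˡ a)
      ; distrib = (λ a b c → trans (*-comm a (b + c))
                                   (trans (distribʳ a b c) (cong₂ _+_ (*-comm b a) (*-comm c a))))
                , distribʳ }
    ; *-comm = *-comm }

  Fp-ring : CommutativeRing 0ℓ 0ℓ
  Fp-ring = record { isCommutativeRing = isCommutativeRing }

  open CommutativeRing Fp-ring
    using (+-identityʳ; *-identityʳ; -‿inverseʳ; distribˡ; zeroˡ; zeroʳ)
  open import Algebra.Properties.Ring (CommutativeRing.ring Fp-ring)
    using (-0#≈0#; -‿involutive; -‿+-comm; -‿distribˡ-*; +-cancelʳ; +-inverseʳ-unique; x[y-z]≈xy-xz)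
  open import Algebra.Properties.CommutativeSemigroup
    (CommutativeRing.+-commutativeSemigroup Fp-ring)
    using (interchange)

  −-interchange : ∀ a b c d → (a - b) + (c - d) ≡ (a + c) - (b + d)
  −-interchange a b c d = trans (interchange a (- b) c (- d)) (cong ((a + c) +_) (-‿+-comm b d))

  toℕ-0# : toℕ 0# ≡ 0
  toℕ-0# = trans (toℕ-⟦⟧ 0) (m*n%n≡0 0 p)

  -- 𝔽_p is a field: a nonzero c has an inverse, read off from a Bézout
  -- identity for the coprime pair (p, toℕ c).
  inverse : ∀ c → ¬ c ≡ 0# → ∃ λ d → d * c ≡ 1#
  inverse c c≢0 = from-Bézout (coprime-Bézout (prime⇒coprime pp (toℕ<n c)))
    where
    n : ℕ
    n = toℕ c
    instance
      n≢0 : NonZero n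
      n≢0 = ℕ.≢-nonZero (λ n≡0 → c≢0 (toℕ-injective (trans n≡0 (sym toℕ-0#))))
    ⟦y⟧*c : ∀ y → ⟦ y ⟧ * c ≡ ⟦ y ℕ.* n ⟧
    ⟦y⟧*c y = trans (cong (⟦ y ⟧ *_) (sym (⟦toℕ⟧ c))) (⟦⟧-* y n)
    from-Bézout : Bézout.Identity 1 p n → ∃ λ d → d * c ≡ 1#
    from-Bézout (Bézout.+- x y eq) = - ⟦ y ⟧ , (begin
        - ⟦ y ⟧ * c    ≡⟨ -‿distribˡ-* ⟦ y ⟧ c ⟨
        - (⟦ y ⟧ * c)  ≡⟨ cong (-_) (+-inverseʳ-unique 1# (⟦ y ⟧ * c) 1+yc≡0) ⟩
        - - 1#         ≡⟨ -‿involutive 1# ⟩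
        1#             ∎)
      where
      open ≡-Reasoning
      1+yc≡0 : 1# + ⟦ y ⟧ * c ≡ 0#
      1+yc≡0 = begin
        1# + ⟦ y ⟧ * c         ≡⟨ cong (1# +_) (⟦y⟧*c y) ⟩
        ⟦ 1 ⟧ + ⟦ y ℕ.* n ⟧    ≡⟨ ⟦⟧-+ 1 (y ℕ.* n) ⟩
        ⟦ 1 ℕ.+ y ℕ.* n ⟧      ≡⟨ cong ⟦_⟧ eq ⟩
        ⟦ x ℕ.* p ⟧            ≡⟨ ⟦⟧-cong (trans (m*n%n≡0 x p) (sym (m*n%n≡0 0 p))) ⟩
        0#                     ∎
    from-Bézout (Bézout.-+ x y eq) =
      ⟦ y ⟧ , trans (⟦y⟧*c y) (trans (cong ⟦_⟧ (sym eq)) (⟦⟧-cong ([m+kn]%n≡m%n 1 x p)))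

  infixl 6 _+ᵛ_ _-ᵛ_
  infixr 7 _*ᵛ_

  _+ᵛ_ _-ᵛ_ : ∀ {k} → Vec Fp k → Vec Fp k → Vec Fp k
  _+ᵛ_ = zipWith _+_
  _-ᵛ_ = zipWith _-_

  _*ᵛ_ : ∀ {k} → Fp → Vec Fp k → Vec Fp k
  c *ᵛ x = map (c *_) x

  0ᵛ : ∀ {k} → Vec Fp k
  0ᵛ = replicate _ 0#

  infix 9 _∙_
  _∙_ : ∀ {k} → Vec Fp k → Vec Fp k → Fp
  _∙_ = dot p pp

  dot-comm : ∀ {k} (x y : Vec Fp k) → x ∙ y ≡ y ∙ x
  dot-comm []      []      = refl
  dot-comm (a ∷ x) (b ∷ y) = cong₂ _+_ (*-comm a b) (dot-comm x y)

  dot-zeroˡ : ∀ {k} (y : Vec Fp k) → 0ᵛ ∙ y ≡ 0#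
  dot-zeroˡ []      = refl
  dot-zeroˡ (b ∷ y) = trans (cong₂ _+_ (zeroˡ b) (dot-zeroˡ y)) (+-identityˡ 0#)

  dot-zeroʳ : ∀ {k} (x : Vec Fp k) → x ∙ 0ᵛ ≡ 0#
  dot-zeroʳ x = trans (dot-comm x 0ᵛ) (dot-zeroˡ x)

  dot-+ˡ : ∀ {k} (x y z : Vec Fp k) → (x +ᵛ y) ∙ z ≡ x ∙ z + y ∙ z
  dot-+ˡ []      []      []      = sym (+-identityˡ 0#)
  dot-+ˡ (a ∷ x) (b ∷ y) (c ∷ z) =
    trans (cong₂ _+_ (distribʳ c a b) (dot-+ˡ x y z)) (interchange (a * c) (b * c) (x ∙ z) (y ∙ z))

  dot-+ʳ : ∀ {k} (x y z : Vec Fp k) → x ∙ (y +ᵛ z) ≡ x ∙ y + x ∙ z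
  dot-+ʳ x y z = trans (dot-comm x (y +ᵛ z))
    (trans (dot-+ˡ y z x) (cong₂ _+_ (dot-comm y x) (dot-comm z x)))

  dot-*ʳ : ∀ {k} c (x y : Vec Fp k) → x ∙ (c *ᵛ y) ≡ c * x ∙ y
  dot-*ʳ c []      []      = sym (zeroʳ c)
  dot-*ʳ c (a ∷ x) (b ∷ y) = begin
    a * (c * b) + x ∙ (c *ᵛ y)  ≡⟨ cong₂ _+_ (sym (*-assoc a c b)) (dot-*ʳ c x y) ⟩
    a * c * b + c * x ∙ y       ≡⟨ cong (λ h → h * b + c * x ∙ y) (*-comm a c) ⟩
    c * a * b + c * x ∙ y       ≡⟨ cong (_+ c * x ∙ y) (*-assoc c a b) ⟩
    c * (a * b) + c * x ∙ y     ≡⟨ distribˡ c (a * b) (x ∙ y) ⟨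
    c * (a * b + x ∙ y)         ∎
    where open ≡-Reasoning

  dot-−ʳ : ∀ {k} (x y z : Vec Fp k) → x ∙ (y -ᵛ z) ≡ x ∙ y - x ∙ z
  dot-−ʳ []      []      []      = sym (-‿inverseʳ 0#)
  dot-−ʳ (a ∷ x) (b ∷ y) (c ∷ z) =
    trans (cong₂ _+_ (x[y-z]≈xy-xz a b c) (dot-−ʳ x y z))
          (−-interchange (a * b) (a * c) (x ∙ y) (x ∙ z))

  -- Double orthogonality in 𝔽_p^k: a vector y outside a subspace P is
  -- separated from P by some z ∈ P^⊥ with ⟨z, y⟩ ≠ 0, i.e. P^⊥⊥ ⊆ P.
  -- Membership in P must be decidable, as the proof (Gaussian elimination
  -- on the first coordinate, then induction on k) inspects P.
  record IsDecSubspace {k} (P : Vec Fp k → Set) : Set where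
    field
      member?  : ∀ y → Dec (P y)
      0∈       : P 0ᵛ
      +-closed : ∀ {x y} → P x → P y → P (x +ᵛ y)
      *-closed : ∀ c {x} → P x → P (c *ᵛ x)

  Separator : ∀ {k} → (Vec Fp k → Set) → Vec Fp k → Set
  Separator P y = ∃ λ z → (∀ w → P w → z ∙ w ≡ 0#) × ¬ z ∙ y ≡ 0#

  Tail : ∀ {k} → (Vec Fp (suc k) → Set) → Vec Fp k → Set
  Tail P u = P (0# ∷ u)

  tail-subspace : ∀ {k} {P : Vec Fp (suc k) → Set} → IsDecSubspace P → IsDecSubspace (Tail P)
  tail-subspace {P = P} S = record
    { member?  = λ u → member? (0# ∷ u)
    ; 0∈       = 0∈
    ; +-closed = λ {x} {y} x∈ y∈ → subst (λ h → P (h ∷ x +ᵛ y)) (+-identityˡ 0#) (+-closed x∈ y∈)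
    ; *-closed = λ c {x} x∈ → subst (λ h → P (h ∷ c *ᵛ x)) (zeroʳ c) (*-closed c x∈)
    }
    where open IsDecSubspace S

  -- If P contains a pivot vector (1, ω), the row operation
  -- (u₀, u) ↦ u − u₀ω maps P into its tail and the complement of P into
  -- the complement of the tail; separators for the tail lift to P.
  module Pivot {k} {P : Vec Fp (suc k) → Set} (S : IsDecSubspace P)
               (ω : Vec Fp k) (pivot∈ : P (1# ∷ ω)) where
    open IsDecSubspace S

    clear : Fp → Vec Fp k → Vec Fp k
    clear u₀ u = u +ᵛ (- u₀) *ᵛ ω

    restore : ∀ u₀ u → (0# + u₀ * 1#) ∷ (clear u₀ u +ᵛ u₀ *ᵛ ω) ≡ u₀ ∷ u
    restore u₀ u = cong₂ _∷_ (trans (+-identityˡ (u₀ * 1#)) (*-identityʳ u₀)) (add-back u ω)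
      where
      add-back : ∀ {m} (v w : Vec Fp m) → (v +ᵛ (- u₀) *ᵛ w) +ᵛ u₀ *ᵛ w ≡ v
      add-back []      []      = refl
      add-back (a ∷ v) (b ∷ w) = cong₂ _∷_ (begin
        (a + - u₀ * b) + u₀ * b   ≡⟨ +-assoc a (- u₀ * b) (u₀ * b) ⟩
        a + (- u₀ * b + u₀ * b)   ≡⟨ cong (a +_) (distribʳ b (- u₀) u₀) ⟨
        a + (- u₀ + u₀) * b       ≡⟨ cong (λ h → a + h * b) (-‿inverseˡ u₀) ⟩
        a + 0# * b                ≡⟨ cong (a +_) (zeroˡ b) ⟩
        a + 0#                    ≡⟨ +-identityʳ a ⟩
        a                         ∎) (add-back v w)
        where open ≡-Reasoning

    clear-∈ : ∀ u₀ u → P (u₀ ∷ u) → Tail P (clear u₀ u)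
    clear-∈ u₀ u u∈ = subst (λ h → P (h ∷ clear u₀ u))
      (trans (cong (u₀ +_) (*-identityʳ (- u₀))) (-‿inverseʳ u₀))
      (+-closed u∈ (*-closed (- u₀) pivot∈))

    clear-∉ : ∀ u₀ u → ¬ P (u₀ ∷ u) → ¬ Tail P (clear u₀ u)
    clear-∉ u₀ u u∉ cleared∈ = u∉ (subst P (restore u₀ u) (+-closed cleared∈ (*-closed u₀ pivot∈)))

    lift : Vec Fp k → Vec Fp (suc k)
    lift z = (- z ∙ ω) ∷ z

    lift-dot : ∀ z u₀ u → lift z ∙ (u₀ ∷ u) ≡ z ∙ clear u₀ u
    lift-dot z u₀ u = begin
      - z ∙ ω * u₀ + z ∙ u       ≡⟨ cong (_+ z ∙ u) (-‿distribˡ-* (z ∙ ω) u₀) ⟨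
      - (z ∙ ω * u₀) + z ∙ u     ≡⟨ cong (λ h → - h + z ∙ u) (*-comm (z ∙ ω) u₀) ⟩
      - (u₀ * z ∙ ω) + z ∙ u     ≡⟨ cong (_+ z ∙ u) (-‿distribˡ-* u₀ (z ∙ ω)) ⟩
      - u₀ * z ∙ ω + z ∙ u       ≡⟨ +-comm (- u₀ * z ∙ ω) (z ∙ u) ⟩
      z ∙ u + - u₀ * z ∙ ω       ≡⟨ cong (z ∙ u +_) (dot-*ʳ (- u₀) z ω) ⟨
      z ∙ u + z ∙ ((- u₀) *ᵛ ω)  ≡⟨ dot-+ʳ z u ((- u₀) *ᵛ ω) ⟨
      z ∙ clear u₀ u             ∎
      where open ≡-Reasoning

    lift-separator : ∀ y₀ y → Separator (Tail P) (clear y₀ y) → Separator P (y₀ ∷ y)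
    lift-separator y₀ y (z , z⊥ , z·y≢0) =
      lift z , (λ { (w₀ ∷ w) w∈ → trans (lift-dot z w₀ w) (z⊥ (clear w₀ w) (clear-∈ w₀ w w∈)) })
             , (λ e → z·y≢0 (trans (sym (lift-dot z y₀ y)) e))

  -- If every vector of P has first coordinate 0, then (1, 0, …, 0)
  -- separates any y with y₀ ≠ 0, and otherwise a separator of the tail,
  -- prefixed by 0, does.
  headless-separator : ∀ {k} {P : Vec Fp (suc k) → Set} →
    (∀ w₀ w → P (w₀ ∷ w) → w₀ ≡ 0#) → (∀ y → ¬ Tail P y → Separator (Tail P) y) →
    ∀ y₀ y → ¬ P (y₀ ∷ y) → Separator P (y₀ ∷ y)
  headless-separator {k} {P} headless separate-tail y₀ y y∉ with y₀ Fin.≟ 0#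
  ... | no y₀≢0 = (1# ∷ 0ᵛ) , (λ { (w₀ ∷ w) w∈ → trans (first w₀ w) (headless w₀ w w∈) })
                            , (λ e → y₀≢0 (trans (sym (first y₀ y)) e))
    where
    first : ∀ w₀ w → (1# ∷ 0ᵛ) ∙ (w₀ ∷ w) ≡ w₀
    first w₀ w = trans (cong₂ _+_ (*-identityˡ w₀) (dot-zeroˡ w)) (+-identityʳ w₀)
  ... | yes refl with separate-tail y y∉
  ...   | z , z⊥ , z·y≢0 = (0# ∷ z) , (λ { (w₀ ∷ w) w∈ → trans (skip w₀ w) (z⊥ w (subst (λ h → P (h ∷ w)) (headless w₀ w w∈) w∈)) })
                                     , (λ e → z·y≢0 (trans (sym (skip 0# y)) e))
    where
    skip : ∀ w₀ w → (0# ∷ z) ∙ (w₀ ∷ w) ≡ z ∙ w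
    skip w₀ w = trans (cong (_+ z ∙ w) (zeroˡ w₀)) (+-identityˡ (z ∙ w))

  -- Double orthogonality, by induction on k: if some vector of P has a
  -- nonzero first coordinate, rescale it to a pivot; otherwise P is headless.
  separate : ∀ {k} {P : Vec Fp k → Set} → IsDecSubspace P → ∀ y → ¬ P y → Separator P y
  separate {zero} S [] y∉ = ⊥-elim (y∉ (IsDecSubspace.0∈ S))
  separate {suc k} {P} S (y₀ ∷ y) y∉ with pivot?
    where
    open IsDecSubspace S
    pivot? : Dec (∃ λ w → P w × ¬ head w ≡ 0#)
    pivot? = Vec-exhaustible Fin-exhaustible (suc k) (λ w → member? w ×-dec ¬? (head w Fin.≟ 0#))
  ... | no no-pivot = headless-separator headless (separate (tail-subspace S)) y₀ y y∉
    where
    headless : ∀ w₀ w → P (w₀ ∷ w) → w₀ ≡ 0#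
    headless w₀ w w∈ = decidable-stable (w₀ Fin.≟ 0#) (λ w₀≢0 → no-pivot ((w₀ ∷ w) , w∈ , w₀≢0))
  ... | yes ((c ∷ w) , cw∈ , c≢0) with inverse c c≢0
  ...   | d , dc≡1 =
    lift-separator y₀ y (separate (tail-subspace S) (clear y₀ y) (clear-∉ y₀ y y∉))
    where
    -- d·(c, w) = (1, d w) is a pivot
    open Pivot S (d *ᵛ w) (subst (λ h → P (h ∷ d *ᵛ w)) dc≡1 (IsDecSubspace.*-closed S d cw∈))

  x-0≡x : ∀ x → x - 0# ≡ x
  x-0≡x x = trans (cong (x +_) -0#≈0#) (+-identityʳ x)

  minuend-zero : ∀ a b → a - b ≡ 0# → b ≡ 0# → a ≡ 0#
  minuend-zero a _ a-b≡0 refl = trans (sym (x-0≡x a)) a-b≡0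

  subtrahend-zero : ∀ a b → a - b ≡ 0# → a ≡ 0# → b ≡ 0#
  subtrahend-zero _ b a-b≡0 refl = begin
    b        ≡⟨ -‿involutive b ⟨
    - - b    ≡⟨ cong (-_) (trans (sym (+-identityˡ (- b))) a-b≡0) ⟩
    - 0#     ≡⟨ -0#≈0# ⟩
    0#       ∎
    where open ≡-Reasoning

  left-difference : ∀ a b c d → (a - b) + (c - d) ≡ 0# → c ≡ 0# → d ≡ 0# → a - b ≡ 0#
  left-difference a b _ _ sum≡0 refl refl =
    trans (sym (trans (cong ((a - b) +_) (x-0≡x 0#)) (+-identityʳ (a - b)))) sum≡0

  right-difference : ∀ a b c d → (a - b) + (c - d) ≡ 0# → a ≡ 0# → b ≡ 0# → c - d ≡ 0#
  right-difference _ _ c d sum≡0 refl refl =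
    trans (sym (trans (cong (_+ (c - d)) (x-0≡x 0#)) (+-identityˡ (c - d)))) sum≡0

  V2 : ℕ → Set
  V2 k = V2k p pp k

  infixl 6 _⊞_
  _⊞_ : ∀ {k} → V2 k → V2 k → V2 k
  _⊞_ = _⊕_ p pp

  0² : ∀ {k} → V2 k
  0² = zero2k p pp

  πₒ πₑ : ∀ {k} → V2 k → Vec Fp k
  πₒ = πo p pp
  πₑ = πe p pp

  φ : ∀ {k} → V2 k → V2 k → Fp
  φ = Φ p pp

  _∈₂_ : ∀ {k} → V2 k → Subset2k p pp k → Set
  _∈₂_ = _∈_ p pp

  _≟²_ : ∀ {k} → DecidableEquality (V2 k)
  _≟²_ = Vec.≡-dec (Product.≡-dec Fin._≟_ Fin._≟_)

  πₒ-⊞ : ∀ {k} (s t : V2 k) → πₒ (s ⊞ t) ≡ πₒ s +ᵛ πₒ t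
  πₒ-⊞ []      []      = refl
  πₒ-⊞ (_ ∷ s) (_ ∷ t) = cong (_ ∷_) (πₒ-⊞ s t)

  πₑ-⊞ : ∀ {k} (s t : V2 k) → πₑ (s ⊞ t) ≡ πₑ s +ᵛ πₑ t
  πₑ-⊞ []      []      = refl
  πₑ-⊞ (_ ∷ s) (_ ∷ t) = cong (_ ∷_) (πₑ-⊞ s t)

  πₑ-scale : ∀ {k} c (s : V2 k) → πₑ (_·_ p pp c s) ≡ c *ᵛ πₑ s
  πₑ-scale c []      = refl
  πₑ-scale c (_ ∷ s) = cong (_ ∷_) (πₑ-scale c s)

  πₒ-0² : ∀ {k} → πₒ (0² {k}) ≡ 0ᵛ
  πₒ-0² {zero}  = refl
  πₒ-0² {suc k} = cong (0# ∷_) (πₒ-0² {k})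

  πₑ-0² : ∀ {k} → πₑ (0² {k}) ≡ 0ᵛ
  πₑ-0² {zero}  = refl
  πₑ-0² {suc k} = cong (0# ∷_) (πₑ-0² {k})

  ⊞-identityʳ : ∀ {k} (s : V2 k) → s ⊞ 0² ≡ s
  ⊞-identityʳ []             = refl
  ⊞-identityʳ ((a , b) ∷ s) = cong₂ _∷_ (cong₂ _,_ (+-identityʳ a) (+-identityʳ b)) (⊞-identityʳ s)

  ⊞-cancelʳ : ∀ {k} (s t a : V2 k) → s ⊞ a ≡ t ⊞ a → s ≡ t
  ⊞-cancelʳ []              []              []              _ = refl
  ⊞-cancelʳ ((s₁ , s₂) ∷ s) ((t₁ , t₂) ∷ t) ((a₁ , a₂) ∷ a) eq =
    cong₂ _∷_ (cong₂ _,_ (+-cancelʳ a₁ s₁ t₁ (cong proj₁ (∷-injectiveˡ eq)))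
                         (+-cancelʳ a₂ s₂ t₂ (cong proj₂ (∷-injectiveˡ eq))))
              (⊞-cancelʳ s t a (∷-injectiveʳ eq))

  translate-by-zero : ∀ {k} (U : Subset2k p pp k) → IsTranslate p pp U U 0²
  translate-by-zero U x =
    mk⇔ (λ x∈ → x , x∈ , sym (⊞-identityʳ x))
        (λ { (v , v∈ , refl) → subst (_∈₂ U) (sym (⊞-identityʳ v)) v∈ })

  odd : ∀ {k} → Vec Fp k → V2 k
  odd = map (_, 0#)

  πₒ-odd : ∀ {k} (z : Vec Fp k) → πₒ (odd z) ≡ z
  πₒ-odd []      = refl
  πₒ-odd (c ∷ z) = cong (c ∷_) (πₒ-odd z)

  πₑ-odd : ∀ {k} (z : Vec Fp k) → πₑ (odd z) ≡ 0ᵛ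
  πₑ-odd []      = refl
  πₑ-odd (c ∷ z) = cong (0# ∷_) (πₑ-odd z)

  D : ∀ {k} → V2 k → V2 k → Fp
  D s t = πₒ s ∙ πₑ t

  D-zeroˡ : ∀ {k} (t : V2 k) → D 0² t ≡ 0#
  D-zeroˡ t = trans (cong (_∙ πₑ t) πₒ-0²) (dot-zeroˡ (πₑ t))

  D-zeroʳ : ∀ {k} (s : V2 k) → D s 0² ≡ 0#
  D-zeroʳ s = trans (cong (πₒ s ∙_) πₑ-0²) (dot-zeroʳ (πₒ s))

  Φ-as-dot : ∀ {k} (u v : V2 k) → φ u v ≡ πₒ u ∙ (πₑ v -ᵛ πₑ u)
  Φ-as-dot []      []      = refl
  Φ-as-dot (a ∷ u) (b ∷ v) = cong (proj₁ a * (proj₂ b - proj₂ a) +_) (Φ-as-dot u v)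

  Φ-as-D : ∀ {k} (u v : V2 k) → φ u v ≡ D u v - D u u
  Φ-as-D u v = trans (Φ-as-dot u v) (dot-−ʳ (πₒ u) (πₑ v) (πₑ u))

  -ᵛ-translate : ∀ {k} (y z w : Vec Fp k) → (y +ᵛ w) -ᵛ (z +ᵛ w) ≡ y -ᵛ z
  -ᵛ-translate []      []      []      = refl
  -ᵛ-translate (a ∷ y) (b ∷ z) (c ∷ w) = cong₂ _∷_ cancel (-ᵛ-translate y z w)
    where
    open ≡-Reasoning
    cancel : (a + c) - (b + c) ≡ a - b
    cancel = begin
      (a + c) - (b + c)     ≡⟨ −-interchange a b c c ⟨
      (a - b) + (c - c)     ≡⟨ cong ((a - b) +_) (-‿inverseʳ c) ⟩
      (a - b) + 0#          ≡⟨ +-identityʳ (a - b) ⟩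
      a - b                 ∎

  Φ-translate : ∀ {k} (s t a : V2 k) → φ (s ⊞ a) (t ⊞ a) ≡ (D s t - D s s) + (D a t - D a s)
  Φ-translate s t a = begin
    φ (s ⊞ a) (t ⊞ a)                                    ≡⟨ Φ-as-dot (s ⊞ a) (t ⊞ a) ⟩
    πₒ (s ⊞ a) ∙ (πₑ (t ⊞ a) -ᵛ πₑ (s ⊞ a))              ≡⟨ cong₂ (λ o e → o ∙ (e -ᵛ πₑ (s ⊞ a))) (πₒ-⊞ s a) (πₑ-⊞ t a) ⟩
    (πₒ s +ᵛ πₒ a) ∙ ((πₑ t +ᵛ πₑ a) -ᵛ πₑ (s ⊞ a))      ≡⟨ cong (λ e → (πₒ s +ᵛ πₒ a) ∙ ((πₑ t +ᵛ πₑ a) -ᵛ e)) (πₑ-⊞ s a) ⟩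
    (πₒ s +ᵛ πₒ a) ∙ ((πₑ t +ᵛ πₑ a) -ᵛ (πₑ s +ᵛ πₑ a)) ≡⟨ cong ((πₒ s +ᵛ πₒ a) ∙_) (-ᵛ-translate (πₑ t) (πₑ s) (πₑ a)) ⟩
    (πₒ s +ᵛ πₒ a) ∙ (πₑ t -ᵛ πₑ s)                      ≡⟨ dot-+ˡ (πₒ s) (πₒ a) (πₑ t -ᵛ πₑ s) ⟩
    πₒ s ∙ (πₑ t -ᵛ πₑ s) + πₒ a ∙ (πₑ t -ᵛ πₑ s)        ≡⟨ cong₂ _+_ (dot-−ʳ (πₒ s) (πₑ t) (πₑ s)) (dot-−ʳ (πₒ a) (πₑ t) (πₑ s)) ⟩
    (D s t - D s s) + (D a t - D a s)                    ∎
    where open ≡-Reasoning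

  module _ {k} (V : Subset2k p pp k) (V-subspace : IsSubspace p pp V) where
    private
      0∈V : 0² ∈₂ V
      0∈V = proj₁ V-subspace
      ⊞-closed : ∀ s t → s ∈₂ V → t ∈₂ V → (s ⊞ t) ∈₂ V
      ⊞-closed = proj₁ (proj₂ V-subspace)
      ·-closed : ∀ c s → s ∈₂ V → _·_ p pp c s ∈₂ V
      ·-closed = proj₂ (proj₂ V-subspace)

    W W⊥ : Vec Fp k → Set
    W  = InπeV p pp V
    W⊥ = InπeV⊥ p pp V

    Split : V2 k → Set
    Split x = W⊥ (πₒ x) × W (πₑ x)

    W-subspace : IsDecSubspace W
    W-subspace = record
      { member?  = λ y → Vec-exhaustible (×-exhaustible Fin-exhaustible Fin-exhaustible) k
                           (λ v → (V v Bool.≟ true) ×-dec Vec.≡-dec Fin._≟_ (πₑ v) y)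
      ; 0∈       = 0² , 0∈V , πₑ-0²
      ; +-closed = λ { (s , s∈ , refl) (t , t∈ , refl) → s ⊞ t , ⊞-closed s t s∈ t∈ , πₑ-⊞ s t }
      ; *-closed = λ { c (s , s∈ , refl) → _·_ p pp c s , ·-closed c s s∈ , πₑ-scale c s }
      }

    split-translates-unlinked : ∀ {a s t} → W⊥ (πₒ a) → Split s → Split t → φ (s ⊞ a) (t ⊞ a) ≡ 0#
    split-translates-unlinked {a} {s} {t} a⊥ (s⊥ , s∈W) (_ , t∈W) = begin
      φ (s ⊞ a) (t ⊞ a)                   ≡⟨ Φ-translate s t a ⟩
      (D s t - D s s) + (D a t - D a s)   ≡⟨ cong₂ (λ x y → (x - y) + (D a t - D a s)) (s⊥ _ t∈W) (s⊥ _ s∈W) ⟩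
      (0# - 0#) + (D a t - D a s)         ≡⟨ cong₂ (λ x y → (0# - 0#) + (x - y)) (a⊥ _ t∈W) (a⊥ _ s∈W) ⟩
      (0# - 0#) + (0# - 0#)               ≡⟨ cong₂ _+_ (-‿inverseʳ 0#) (-‿inverseʳ 0#) ⟩
      0# + 0#                             ≡⟨ +-identityˡ 0# ⟩
      0#                                  ∎
      where open ≡-Reasoning

    -- Conversely, if V + a is unlinked then π_o(a) ⊥ W and every vector of
    -- V is split: read off (★) at (0, t), then (s, 0), then (s, t).
    translate-unlinked⇒split : ∀ {a} → (∀ s t → s ∈₂ V → t ∈₂ V → φ (s ⊞ a) (t ⊞ a) ≡ 0#) →
                               W⊥ (πₒ a) × (∀ v → v ∈₂ V → Split v)
    translate-unlinked⇒split {a} unlinked = a⊥ , λ v v∈ → v⊥ v v∈ , (v , v∈ , refl)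
      where
      expanded : ∀ s t → s ∈₂ V → t ∈₂ V → (D s t - D s s) + (D a t - D a s) ≡ 0#
      expanded s t s∈ t∈ = trans (sym (Φ-translate s t a)) (unlinked s t s∈ t∈)
      a⊥ : W⊥ (πₒ a)
      a⊥ _ (t , t∈ , refl) =
        minuend-zero (D a t) (D a 0²)
          (right-difference (D 0² t) (D (0² {k}) 0²) (D a t) (D a 0²) (expanded 0² t 0∈V t∈) (D-zeroˡ t) (D-zeroˡ (0² {k})))
          (D-zeroʳ a)
      self : ∀ s → s ∈₂ V → D s s ≡ 0#
      self s s∈ =
        subtrahend-zero (D s 0²) (D s s)
          (left-difference (D s 0²) (D s s) (D a 0²) (D a s) (expanded s 0² s∈ 0∈V) (D-zeroʳ a) (a⊥ _ (s , s∈ , refl)))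
          (D-zeroʳ s)
      v⊥ : ∀ s → s ∈₂ V → W⊥ (πₒ s)
      v⊥ s s∈ _ (t , t∈ , refl) =
        minuend-zero (D s t) (D s s)
          (left-difference (D s t) (D s s) (D a t) (D a s) (expanded s t s∈ t∈) (a⊥ _ (t , t∈ , refl)) (a⊥ _ (s , s∈ , refl)))
          (self s s∈)

    -- (⇒) If U = V + a is maximal unlinked then V has split form: V ⊆ Split
    -- by the previous lemma, and for split x the set U ∪ {x + a} is still
    -- unlinked, so x + a ∈ U by maximality, i.e. x ∈ V.
    maximal-translate⇒split-form : ∀ {U a} → MaximalUnlinked p pp U → IsTranslate p pp U V a →
                                   SplitForm p pp V
    maximal-translate⇒split-form {U} {a} (U-unlinked , U-maximal) U≡V+a x = mk⇔ (V⊆Split x) Split⊆V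
      where
      +a∈U : ∀ v → v ∈₂ V → (v ⊞ a) ∈₂ U
      +a∈U v v∈ = Equivalence.from (U≡V+a (v ⊞ a)) (v , v∈ , refl)
      split-facts : W⊥ (πₒ a) × (∀ v → v ∈₂ V → Split v)
      split-facts = translate-unlinked⇒split (λ s t s∈ t∈ → U-unlinked _ _ (+a∈U s s∈) (+a∈U t t∈))
      a⊥ : W⊥ (πₒ a)
      a⊥ = proj₁ split-facts
      V⊆Split : ∀ v → v ∈₂ V → Split v
      V⊆Split = proj₂ split-facts
      Split⊆V : Split x → x ∈₂ V
      Split⊆V x-split with Equivalence.to (U≡V+a (x ⊞ a)) (U-maximal U′ U′-unlinked U⊆U′ (x ⊞ a) x+a∈U′)
        where
        U′ : Subset2k p pp k
        U′ = insert _≟²_ (x ⊞ a) U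
        U⊆U′ : _⊆_ p pp U U′
        U⊆U′ = insert-⊇ _≟²_ (x ⊞ a) U
        x+a∈U′ : (x ⊞ a) ∈₂ U′
        x+a∈U′ = insert-∋ _≟²_ (x ⊞ a) U
        split-translate : ∀ z → z ∈₂ U′ → ∃ λ s → Split s × z ≡ s ⊞ a
        split-translate z z∈U′ with insert-cases _≟²_ (x ⊞ a) U z z∈U′
        ... | inj₂ z≡x+a = x , x-split , z≡x+a
        ... | inj₁ z∈U with Equivalence.to (U≡V+a z) z∈U
        ...   | v , v∈ , z≡v+a = v , V⊆Split v v∈ , z≡v+a
        U′-unlinked : Unlinked p pp U′
        U′-unlinked u w u∈ w∈ with split-translate u u∈ | split-translate w w∈
        ... | s , s-split , refl | t , t-split , refl = split-translates-unlinked a⊥ s-split t-split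
      ... | v , v∈ , x+a≡v+a = subst (_∈₂ V) (sym (⊞-cancelʳ x v a x+a≡v+a)) v∈

    -- If U′ ⊇ V is
    -- unlinked and x ∈ U′, then Φ(x, v) = D(x,v) − D(x,x) = 0 for v ∈ V gives
    -- D(x,x) = 0 (take v = 0) and then π_o(x) ∈ W^⊥.  If π_e(x) ∉ W, a
    -- separator z ∈ W^⊥ of π_e(x) gives a split vector (z, 0) ∈ V ⊆ U′ with
    -- Φ((z, 0), x) = z·π_e(x) ≠ 0, a contradiction; so x is split, x ∈ V.
    split-form⇒maximal : SplitForm p pp V → MaximalUnlinked p pp V
    split-form⇒maximal split = V-unlinked , V-maximal
      where
      V⊆Split : ∀ v → v ∈₂ V → Split v
      V⊆Split v = Equivalence.to (split v)
      Split⊆V : ∀ v → Split v → v ∈₂ V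
      Split⊆V v = Equivalence.from (split v)

      0²⊥ : W⊥ (πₒ 0²)
      0²⊥ w _ = trans (cong (_∙ w) πₒ-0²) (dot-zeroˡ w)

      V-unlinked : Unlinked p pp V
      V-unlinked u v u∈ v∈ =
        subst₂ (λ u′ v′ → φ u′ v′ ≡ 0#) (⊞-identityʳ u) (⊞-identityʳ v)
               (split-translates-unlinked 0²⊥ (V⊆Split u u∈) (V⊆Split v v∈))

      V-maximal : ∀ U′ → Unlinked p pp U′ → _⊆_ p pp V U′ → _⊆_ p pp U′ V
      V-maximal U′ U′-unlinked V⊆U′ x x∈U′ = Split⊆V x (x⊥ , x∈W)
        where
        linked : ∀ r → r ∈₂ V → D r x - D r r ≡ 0#
        linked r r∈ = trans (sym (Φ-as-D r x)) (U′-unlinked r x (V⊆U′ r r∈) x∈U′)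
        self : D x x ≡ 0#
        self = subtrahend-zero (D x 0²) (D x x)
                 (trans (sym (Φ-as-D x 0²)) (U′-unlinked x 0² x∈U′ (V⊆U′ 0² 0∈V))) (D-zeroʳ x)
        x⊥ : W⊥ (πₒ x)
        x⊥ _ (v , v∈ , refl) =
          minuend-zero (D x v) (D x x) (trans (sym (Φ-as-D x v)) (U′-unlinked x v x∈U′ (V⊆U′ v v∈))) self
        x∈W : W (πₑ x)
        x∈W = decidable-stable (member? (πₑ x)) (λ x∉W → unseparated (separate W-subspace (πₑ x) x∉W))
          where
          open IsDecSubspace W-subspace using (member?; 0∈)
          unseparated : ¬ Separator W (πₑ x)
          unseparated (z , z⊥ , z·x≢0) = z·x≢0 (begin
            z ∙ πₑ x      ≡⟨ cong (_∙ πₑ x) (πₒ-odd z) ⟨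
            D (odd z) x   ≡⟨ minuend-zero (D (odd z) x) (D (odd z) (odd z)) (linked (odd z) odd-z∈V) odd-self ⟩
            0#            ∎)
            where
            open ≡-Reasoning
            odd-z∈V : odd z ∈₂ V
            odd-z∈V = Split⊆V (odd z) (subst W⊥ (sym (πₒ-odd z)) z⊥ , subst W (sym (πₑ-odd z)) 0∈)
            odd-self : D (odd z) (odd z) ≡ 0#
            odd-self = trans (cong₂ _∙_ (πₒ-odd z) (πₑ-odd z)) (dot-zeroʳ z)

lemma7p3 : (p : ℕ) (pp : Prime p) (k : ℕ) → k ≥ 1 →
    (V : Subset2k p pp k) → IsSubspace p pp V →
    (Σ (Subset2k p pp k) λ U → Σ (V2k p pp k) λ a →
        MaximalUnlinked p pp U × IsTranslate p pp U V a)
      ⇔ SplitForm p pp V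
lemma7p3 p pp k _ V V-subspace = mk⇔
  (λ { (U , a , U-maximal , U≡V+a) → maximal-translate⇒split-form p pp V V-subspace U-maximal U≡V+a })
  (λ split → V , 0² p pp , split-form⇒maximal p pp V V-subspace split , translate-by-zero p pp V)
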